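{- Fix a prime $p\ge5$. The following are equivalent: (i) for every $m\ge1$ and $a=0,1,2,3$, $p^aB_{mp}^{(a)}\equiv B_m^{(a)}\pmod{p^4}$; (ii) for every $m\ge1$, $\Phi_{mp}(pX)\equiv\Phi_m(X)\pmod{(p^4,X^4)}$. Moreover, both are implied by the truncated Dwork congruence \[ \Lambda_p\!\bigl(C(q)H(q)^{pX}\bigr)\equiv C(q)H(q)^X\pmod{(p^4,X^4)}, \] and this $q$-series congruence is equivalent to (ii) holding for all $m\ge1$.
   Context: Let $\chi_3(n)=\left(\frac{n}{3}\right)$. Let $C(q)=1+\sum_{n\ge1}c_nq^n$ with $c_n=3\sum_{d\mid n}\chi_3(d)d^4$. Let $t(q)=q\prod_{n\ge1}(1-q^{3n})^{12}(1-q^n)^{ -12}$, $H(q)=q/t(q)$, $L(q)=\log(t(q)/q)=-\log H(q)$, and $H(q)^X:=\exp(-XL(q))$ for a formal variable $X$. Define $B_m^{(a)}:=[q^m](C(q)L(q)^a)$ and $\Phi_m(X):=[q^m](C(q)H(q)^X)$. For $f=\sum a_nq^n$, $\Lambda_p(f)=\sum a_{np}q^n$. A congruence modulo $(p^4,X^4)$ means that after discarding terms of degree $\ge4$ in $X$, all coefficients of the difference lie in $p^4\mathbf{Z}_{(p)}$; a congruence mod $p^4$ of numbers means the difference lies in $p^4\mathbf{Z}_{(p)}$. -}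

module Defs where

open import Data.Nat as ℕ using (ℕ; zero; suc; _∸_; _!; _%_; NonZero)
open import Data.Nat.Properties using (_!≢0)
open import Data.Nat.Divisibility as ℕD using (_∣?_)
open import Data.Integer as ℤ using (ℤ; +_; -[1+_])
open import Data.Integer.Divisibility as ℤD using ()
open import Data.Rational as ℚ using (ℚ; 0ℚ; 1ℚ; _+_; _*_; _-_; -_)
open import Relation.Nullary using (¬_; yes; no)
open import Data.Fin using (Fin; toℕ)

ℕ→ℚ : ℕ → ℚ
ℕ→ℚ n = + n ℚ./ 1

_^ℚ_ : ℚ → ℕ → ℚ
r ^ℚ zero  = 1ℚ
r ^ℚ suc k = r * (r ^ℚ k)

inv! : ℕ → ℚ
inv! k = (+ 1 ℚ./ (k !)) {{k !≢0}}

inv-suc : ℕ → ℚ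
inv-suc j = + 1 ℚ./ suc j

sumTo : ℕ → (ℕ → ℚ) → ℚ
sumTo zero    f = f 0
sumTo (suc n) f = sumTo n f + f (suc n)

sum1To : ℕ → (ℕ → ℚ) → ℚ
sum1To zero    f = 0ℚ
sum1To (suc n) f = sum1To n f + f (suc n)

-- p-adic congruences.
-- A rational r lies in p^e Z_(p) iff, writing r = a/b in lowest terms,
-- p^e ∣ a and p ∤ b.

InPowZp : ℕ → ℕ → ℚ → Set
InPowZp p e r = ((+ (p ℕ.^ e)) ℤD.∣ ℚ.numerator r) Data.Product.× (¬ (p ℕD.∣ ℚ.denominatorℕ r))
  where import Data.Product

CongQ : ℕ → ℕ → ℚ → ℚ → Set
CongQ p e a b = InPowZp p e (a - b)

PS : Set
PS = ℕ → ℚ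

one : PS
one zero    = 1ℚ
one (suc _) = 0ℚ

_*ₛ_ : PS → PS → PS
(f *ₛ g) m = sumTo m (λ i → f i * g (m ∸ i))

_^ₛ_ : PS → ℕ → PS
f ^ₛ zero  = one
f ^ₛ suc k = f *ₛ (f ^ₛ k)

minusOne : PS → PS
minusOne f zero    = f zero - 1ℚ
minusOne f (suc m) = f (suc m)

-- formal logarithm of a series with constant term 1:
-- log f = Σ_{k≥1} (-1)^{k+1} (f-1)^k / k ; only k ≤ m contribute to [q^m].
logₛ : PS → PS
logₛ f m = sum1To m (λ k → ((- 1ℚ) ^ℚ (k ∸ 1)) * inv-suc (k ∸ 1) * ((minusOne f) ^ₛ k) m)

oneMinusQ : ℕ → PS
oneMinusQ n j with j ℕ.≟ 0 | j ℕ.≟ n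
... | yes _ | _     = 1ℚ
... | no _  | yes _ = - 1ℚ
... | no _  | no _  = 0ℚ

geomQ : ℕ → PS
geomQ n j with n ∣? j
... | yes _ = 1ℚ
... | no _  = 0ℚ

tFactor : ℕ → PS
tFactor n = ((oneMinusQ (3 ℕ.* n)) ^ₛ 12) *ₛ ((geomQ n) ^ₛ 12)

tProdUpTo : ℕ → PS
tProdUpTo zero    = one
tProdUpTo (suc N) = tProdUpTo N *ₛ tFactor (suc N)

-- t(q)/q = Π_{n≥1} (1-q^{3n})^{12}(1-q^n)^{-12}; since the n-th factor is
-- 1 + O(q^n), the q^m coefficient of the infinite product is that of the
-- partial product over n ≤ m.
tOverQ : PS
tOverQ m = tProdUpTo m m

Lser : PS
Lser = logₛ tOverQ

χ₃ : ℕ → ℤ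
χ₃ n with n % 3
... | 0 = + 0
... | 1 = + 1
... | _ = -[1+ 0 ]

Cser : PS
Cser zero    = 1ℚ
Cser (suc n) = ℕ→ℚ 3 * sum1To (suc n) (λ d → divTerm d)
  where
  divTerm : ℕ → ℚ
  divTerm d with d ∣? suc n
  ... | yes _ = (χ₃ d ℚ./ 1) * ℕ→ℚ (d ℕ.^ 4)
  ... | no _  = 0ℚ

B : ℕ → ℕ → ℚ
B a m = (Cser *ₛ (Lser ^ₛ a)) m

-- Series in q with coefficients in ℚ[[X]]:  f m k = [q^m X^k] f.

PS2 : Set
PS2 = ℕ → ℕ → ℚ

_*₂_ : PS2 → PS2 → PS2
(f *₂ g) m k = sumTo m (λ i → sumTo k (λ j → f i j * g (m ∸ i) (k ∸ j)))

ι : PS → PS2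
ι f m zero    = f m
ι f m (suc _) = 0ℚ

-- H(q)^{sX} := exp(-sX L(q)) = Σ_k (-s X)^k L(q)^k / k!
HpowX : ℚ → PS2
HpowX s m k = ((- s) ^ℚ k) * inv! k * (Lser ^ₛ k) m

CHX : PS2
CHX = ι Cser *₂ HpowX 1ℚ

CHpX : ℕ → PS2
CHpX p = ι Cser *₂ HpowX (ℕ→ℚ p)

Φ : ℕ → ℕ → ℚ
Φ m k = CHX m k

Λ : ℕ → PS2 → PS2
Λ p f m k = f (m ℕ.* p) k

CondI : ℕ → Set
CondI p = ∀ (m : ℕ) → 1 ℕ.≤ m → (a : Fin 4) →
  CongQ p 4 ((ℕ→ℚ p ^ℚ toℕ a) * B (toℕ a) (m ℕ.* p)) (B (toℕ a) m)

-- (ii) ∀ m ≥ 1:  Φ_{mp}(pX) ≡ Φ_m(X)  (mod (p^4, X^4)),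
-- i.e. for each k < 4:  p^k [X^k]Φ_{mp} ≡ [X^k]Φ_m (mod p^4)
CondII : ℕ → Set
CondII p = ∀ (m : ℕ) → 1 ℕ.≤ m → (k : Fin 4) →
  CongQ p 4 ((ℕ→ℚ p ^ℚ toℕ k) * Φ (m ℕ.* p) (toℕ k)) (Φ m (toℕ k))

Dwork : ℕ → Set
Dwork p = ∀ (m : ℕ) (k : Fin 4) → CongQ p 4 (Λ p (CHpX p) m (toℕ k)) (CHX m (toℕ k))

{-# OPTIONS --safe #-}
module Submission where

open import Defs
open import Data.Nat using (ℕ; _≤_)
open import Data.Nat.Primality using (Prime)
open import Data.Product using (_×_)
open import Function.Bundles using (_⇔_)

open import Data.Nat as ℕ using (zero; suc; _<_; _^_; _!; NonZero; s≤s; z≤n)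
import Data.Nat.Properties as ℕₚ
open import Data.Nat.Divisibility
  using (_∣_; divides; ∣-trans; 1∣_; _∣0; ∣1⇒≡1; ∣⇒≤; m∣m*n; ∣n⇒∣m*n; *-monoʳ-∣; *-cancelˡ-∣)
open import Data.Nat.Coprimality using (1-coprimeTo) renaming (sym to coprime-sym)
open import Data.Nat.GCD using (gcd; gcd[m,n]∣n)
open import Data.Nat.Primality using (euclidsLemma; prime⇒nonZero; prime⇒nonTrivial)
import Data.Integer as ℤ
import Data.Integer.Properties as ℤₚ
open import Data.Rational as ℚ using (ℚ; mkℚ; 0ℚ; 1ℚ; _+_; _*_; _-_; -_; _/_; ↥_; ↧ₙ_)
import Data.Rational.Properties as ℚₚ
open import Data.Rational.Solver using (module +-*-Solver)
open import Data.Fin using (toℕ)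
import Data.Fin.Properties as Finₚ
open import Data.Product using (_,_)
open import Data.Sum using (inj₁; inj₂; [_,_]′)
open import Data.Empty using (⊥-elim)
open import Function.Bundles using (mk⇔)
open import Relation.Nullary using (¬_)
open import Relation.Binary.PropositionalEquality

open +-*-Solver

-- Since H^X = exp(-X L), the X^k-coefficient of Φ_m(X) is ((-1)^k / k!) B_m^(k), and the
-- X^k-coefficient of the q^m-term of Λ_p(C H^(pX)) is p^k times that of Φ_(mp)(X).
-- So all three congruences compare the same differences p^k B_(mp)^(k) - B_m^(k), up to the
-- factor (-1)^k / k!, which is a p-adic unit for k ≤ 3 < p. The q^0-term of the Dwork
-- congruence holds for free because L has no constant term.

InZp : ℕ → ℚ → Set
InZp p r = ¬ p ∣ ↧ₙ r

∣↥-/∣*gcd : ∀ i n .{{_ : NonZero n}} → ℤ.∣ ↥ (i / n) ∣ ℕ.* gcd ℤ.∣ i ∣ n ≡ ℤ.∣ i ∣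
∣↥-/∣*gcd i n = trans (sym (ℤₚ.abs-* (↥ (i / n)) (ℤ.+ gcd ℤ.∣ i ∣ n))) (cong ℤ.∣_∣ (ℚₚ.↥-/ i n))

↧ₙ-/∣ : ∀ i n .{{_ : NonZero n}} → ↧ₙ (i / n) ∣ n
↧ₙ-/∣ i n = divides g (trans (sym (cong ℤ.∣_∣ (ℚₚ.↧-/ i n)))
                              (trans (ℤₚ.abs-* (ℚ.↧ (i / n)) (ℤ.+ g)) (ℕₚ.*-comm (↧ₙ (i / n)) g)))
  where
  g : ℕ
  g = gcd ℤ.∣ i ∣ n

ℕ→ℚ*1/n : ∀ n .{{_ : NonZero n}} → ℕ→ℚ n * (ℤ.+ 1 / n) ≡ 1ℚ
ℕ→ℚ*1/n (suc m) = begin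
  ℕ→ℚ (suc m) * (ℤ.+ 1 / suc m)  ≡⟨ cong₂ _*_ (ℚₚ.↥p/↧p≡p n/1) (ℚₚ.↥p/↧p≡p 1/n) ⟩
  n/1 * 1/n                      ≡⟨ ℚₚ.*-inverseʳ n/1 ⟩
  1ℚ                             ∎
  where
  open ≡-Reasoning
  n/1 1/n : ℚ
  n/1 = mkℚ (ℤ.+ suc m) 0 (coprime-sym (1-coprimeTo (suc m)))
  1/n = mkℚ (ℤ.+ 1) m (1-coprimeTo (suc m))

expCoeff : ℕ → ℚ
expCoeff k = (- 1ℚ) ^ℚ k * inv! k

expCoeff⁻¹ : ℕ → ℚ
expCoeff⁻¹ k = (- 1ℚ) ^ℚ k * ℕ→ℚ (k !)

expCoeff⁻¹*expCoeff : ∀ k → expCoeff⁻¹ k * expCoeff k ≡ 1ℚ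
expCoeff⁻¹*expCoeff k = begin
  (σ k * ℕ→ℚ (k !)) * (σ k * inv! k)  ≡⟨ solve 3 (λ s n i → (s :* n) :* (s :* i) := (s :* s) :* (n :* i))
                                                  refl (σ k) (ℕ→ℚ (k !)) (inv! k) ⟩
  (σ k * σ k) * (ℕ→ℚ (k !) * inv! k)  ≡⟨ cong₂ _*_ (σ*σ≡1 k) (ℕ→ℚ*1/n (k !) {{k ℕₚ.!≢0}}) ⟩
  1ℚ                                  ∎
  where
  open ≡-Reasoning
  σ : ℕ → ℚ
  σ k = (- 1ℚ) ^ℚ k
  σ*σ≡1 : ∀ k → σ k * σ k ≡ 1ℚ
  σ*σ≡1 zero    = refl
  σ*σ≡1 (suc k) = trans (solve 1 (λ s → (:- con 1ℚ :* s) :* (:- con 1ℚ :* s) := s :* s) refl (σ k)) (σ*σ≡1 k)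

module _ {p : ℕ} (p-prime : Prime p) where

  p∤1 : ¬ p ∣ 1
  p∤1 p∣1 = ℕ.nonTrivial⇒≢1 {{prime⇒nonTrivial p-prime}} (∣1⇒≡1 p∣1)

  ∤-* : ∀ {m n} → ¬ p ∣ m → ¬ p ∣ n → ¬ p ∣ m ℕ.* n
  ∤-* {m} {n} p∤m p∤n p∣mn = [ p∤m , p∤n ]′ (euclidsLemma m n p-prime p∣mn)

  ∤! : ∀ {k} → k < p → ¬ p ∣ k !
  ∤! {zero}  _   = p∤1
  ∤! {suc k} k<p = ∤-* (λ p∣k+1 → ℕₚ.<⇒≱ k<p (∣⇒≤ p∣k+1)) (∤! (ℕₚ.<-trans (ℕₚ.n<1+n k) k<p))

  ^∣*-cancelʳ : ∀ e {m n} → ¬ p ∣ n → p ^ e ∣ m ℕ.* n → p ^ e ∣ m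
  ^∣*-cancelʳ zero    _   _ = 1∣ _
  ^∣*-cancelʳ (suc e) {m} {n} p∤n pᵉ⁺¹∣mn with euclidsLemma m n p-prime (∣-trans (m∣m*n (p ^ e)) pᵉ⁺¹∣mn)
  ... | inj₂ p∣n = ⊥-elim (p∤n p∣n)
  ... | inj₁ (divides q refl) = subst (p ℕ.* p ^ e ∣_) (ℕₚ.*-comm p q) (*-monoʳ-∣ p pᵉ∣q)
    where
    qpn≡p[qn] : q ℕ.* p ℕ.* n ≡ p ℕ.* (q ℕ.* n)
    qpn≡p[qn] = trans (cong (ℕ._* n) (ℕₚ.*-comm q p)) (ℕₚ.*-assoc p q n)
    pᵉ∣q : p ^ e ∣ q
    pᵉ∣q = ^∣*-cancelʳ e p∤n
             (*-cancelˡ-∣ p {{prime⇒nonZero p-prime}} (subst (p ℕ.* p ^ e ∣_) qpn≡p[qn] pᵉ⁺¹∣mn))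

  InZp-/ : ∀ i n .{{_ : NonZero n}} → ¬ p ∣ n → InZp p (i / n)
  InZp-/ i n p∤n p∣↧ = p∤n (∣-trans p∣↧ (↧ₙ-/∣ i n))

  InPowZp-/ : ∀ e i n .{{_ : NonZero n}} → p ^ e ∣ ℤ.∣ i ∣ → ¬ p ∣ n → InPowZp p e (i / n)
  InPowZp-/ e i n pᵉ∣i p∤n =
    ^∣*-cancelʳ e p∤gcd (subst (p ^ e ∣_) (sym (∣↥-/∣*gcd i n)) pᵉ∣i) , InZp-/ i n p∤n
    where
    p∤gcd : ¬ p ∣ gcd ℤ.∣ i ∣ n
    p∤gcd p∣gcd = p∤n (∣-trans p∣gcd (gcd[m,n]∣n ℤ.∣ i ∣ n))

  InPowZp-*ˡ : ∀ e c r → InZp p c → InPowZp p e r → InPowZp p e (c * r)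
  InPowZp-*ˡ e c@record{} r@record{} p∤c (pᵉ∣r , p∤r) =
    InPowZp-/ e (↥ c ℤ.* ↥ r) (↧ₙ c ℕ.* ↧ₙ r)
      (subst (p ^ e ∣_) (sym (ℤₚ.abs-* (↥ c) (↥ r))) (∣n⇒∣m*n ℤ.∣ ↥ c ∣ pᵉ∣r)) (∤-* p∤c p∤r)

  InZp-* : ∀ r s → InZp p r → InZp p s → InZp p (r * s)
  InZp-* r@record{} s@record{} p∤r p∤s = InZp-/ (↥ r ℤ.* ↥ s) (↧ₙ r ℕ.* ↧ₙ s) (∤-* p∤r p∤s)

  InZp-^ : ∀ r k → InZp p r → InZp p (r ^ℚ k)
  InZp-^ r zero    _   = p∤1
  InZp-^ r (suc k) p∤r = InZp-* r (r ^ℚ k) p∤r (InZp-^ r k p∤r)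

  InPowZp-0 : ∀ e → InPowZp p e 0ℚ
  InPowZp-0 e = (_ ∣0) , p∤1

  InPowZp-cancelˡ : ∀ e u c r → InZp p u → u * c ≡ 1ℚ → InPowZp p e (c * r) → InPowZp p e r
  InPowZp-cancelˡ e u c r p∤u uc≡1 pᵉ∣cr = subst (InPowZp p e) u[cr]≡r (InPowZp-*ˡ e u (c * r) p∤u pᵉ∣cr)
    where
    u[cr]≡r : u * (c * r) ≡ r
    u[cr]≡r = trans (sym (ℚₚ.*-assoc u c r)) (trans (cong (_* r) uc≡1) (ℚₚ.*-identityˡ r))

  InZp-expCoeff : ∀ {k} → k < p → InZp p (expCoeff k)
  InZp-expCoeff {k} k<p = InZp-* ((- 1ℚ) ^ℚ k) (inv! k) (InZp-^ (- 1ℚ) k p∤1)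
                                 (InZp-/ (ℤ.+ 1) (k !) {{k ℕₚ.!≢0}} (∤! k<p))

  InZp-expCoeff⁻¹ : ∀ k → InZp p (expCoeff⁻¹ k)
  InZp-expCoeff⁻¹ k = InZp-* ((- 1ℚ) ^ℚ k) (ℕ→ℚ (k !)) (InZp-^ (- 1ℚ) k p∤1) (InZp-/ (ℤ.+ (k !)) 1 p∤1)

sumTo-cong : ∀ n {f g : ℕ → ℚ} → (∀ i → f i ≡ g i) → sumTo n f ≡ sumTo n g
sumTo-cong zero    f≗g = f≗g 0
sumTo-cong (suc n) f≗g = cong₂ _+_ (sumTo-cong n f≗g) (f≗g (suc n))

*-distribˡ-sumTo : ∀ n c (f : ℕ → ℚ) → sumTo n (λ i → c * f i) ≡ c * sumTo n f
*-distribˡ-sumTo zero    c f = refl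
*-distribˡ-sumTo (suc n) c f = trans (cong (_+ c * f (suc n)) (*-distribˡ-sumTo n c f))
                                     (sym (ℚₚ.*-distribˡ-+ c (sumTo n f) (f (suc n))))

sumTo-head : ∀ n (f : ℕ → ℚ) → (∀ i → f (suc i) ≡ 0ℚ) → sumTo n f ≡ f 0
sumTo-head zero    f f₊≡0 = refl
sumTo-head (suc n) f f₊≡0 = trans (cong₂ _+_ (sumTo-head n f f₊≡0) (f₊≡0 n)) (ℚₚ.+-identityʳ (f 0))

*ₛ-scaleʳ : ∀ (f g : PS) c m → (f *ₛ (λ n → c * g n)) m ≡ c * (f *ₛ g) m
*ₛ-scaleʳ f g c m = trans (sumTo-cong m (λ i → swap (f i) c (g (m ℕ.∸ i))))
                          (*-distribˡ-sumTo m c (λ i → f i * g (m ℕ.∸ i)))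
  where
  swap : ∀ x c y → x * (c * y) ≡ c * (x * y)
  swap = solve 3 (λ x c y → x :* (c :* y) := c :* (x :* y)) refl

ι-*₂ : ∀ f (g : PS2) m k → (ι f *₂ g) m k ≡ (f *ₛ (λ n → g n k)) m
ι-*₂ f g m k = sumTo-cong m (λ i →
  sumTo-head k (λ j → ι f i j * g (m ℕ.∸ i) (k ℕ.∸ j)) (λ j → ℚₚ.*-zeroˡ (g (m ℕ.∸ i) (k ℕ.∸ suc j))))

C·HpowX-coeff : ∀ s m k → (ι Cser *₂ HpowX s) m k ≡ (- s) ^ℚ k * inv! k * B k m
C·HpowX-coeff s m k = trans (ι-*₂ Cser (HpowX s) m k) (*ₛ-scaleʳ Cser (Lser ^ₛ k) ((- s) ^ℚ k * inv! k) m)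

Φ-coeff : ∀ m k → Φ m k ≡ expCoeff k * B k m
Φ-coeff = C·HpowX-coeff 1ℚ

B-suc-zero : ∀ a → B (suc a) 0 ≡ 0ℚ
B-suc-zero a = trans (ℚₚ.*-identityˡ (0ℚ * (Lser ^ₛ a) 0)) (ℚₚ.*-zeroˡ ((Lser ^ₛ a) 0))

Φ-zero-suc : ∀ k → Φ 0 (suc k) ≡ 0ℚ
Φ-zero-suc k = trans (Φ-coeff 0 (suc k))
  (trans (cong (expCoeff (suc k) *_) (B-suc-zero k)) (ℚₚ.*-zeroʳ (expCoeff (suc k))))

x^k*Φ₀-Φ₀≡0 : ∀ x k → x ^ℚ k * Φ 0 k - Φ 0 k ≡ 0ℚ
x^k*Φ₀-Φ₀≡0 x zero    = solve 1 (λ y → con 1ℚ :* y :- y := con 0ℚ) refl (Φ 0 0)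
x^k*Φ₀-Φ₀≡0 x (suc k) = begin
  x ^ℚ suc k * Φ 0 (suc k) - Φ 0 (suc k)  ≡⟨ cong (λ y → x ^ℚ suc k * y - y) (Φ-zero-suc k) ⟩
  x ^ℚ suc k * 0ℚ - 0ℚ                    ≡⟨ solve 1 (λ a → a :* con 0ℚ :- con 0ℚ := con 0ℚ) refl (x ^ℚ suc k) ⟩
  0ℚ                                      ∎
  where open ≡-Reasoning

neg-^ : ∀ x k → (- x) ^ℚ k ≡ x ^ℚ k * (- 1ℚ) ^ℚ k
neg-^ x zero    = refl
neg-^ x (suc k) = trans (cong (- x *_) (neg-^ x k))
  (solve 3 (λ x a b → :- x :* (a :* b) := (x :* a) :* (:- con 1ℚ :* b)) refl x (x ^ℚ k) ((- 1ℚ) ^ℚ k))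

module _ (p : ℕ) where

  private
    P : ℚ
    P = ℕ→ℚ p

  Λ-CHpX-coeff : ∀ m k → Λ p (CHpX p) m k ≡ P ^ℚ k * Φ (m ℕ.* p) k
  Λ-CHpX-coeff m k = begin
    Λ p (CHpX p) m k                               ≡⟨ C·HpowX-coeff P (m ℕ.* p) k ⟩
    (- P) ^ℚ k * inv! k * B k (m ℕ.* p)            ≡⟨ cong (λ x → x * inv! k * B k (m ℕ.* p)) (neg-^ P k) ⟩
    P ^ℚ k * (- 1ℚ) ^ℚ k * inv! k * B k (m ℕ.* p)  ≡⟨ solve 4 (λ a s i b → a :* s :* i :* b := a :* (s :* i :* b))
                                                         refl (P ^ℚ k) ((- 1ℚ) ^ℚ k) (inv! k) (B k (m ℕ.* p)) ⟩
    P ^ℚ k * (expCoeff k * B k (m ℕ.* p))          ≡⟨ cong (P ^ℚ k *_) (sym (Φ-coeff (m ℕ.* p) k)) ⟩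
    P ^ℚ k * Φ (m ℕ.* p) k                         ∎
    where open ≡-Reasoning

  Dwork-defect : ∀ m k → Λ p (CHpX p) m k - CHX m k ≡ P ^ℚ k * Φ (m ℕ.* p) k - Φ m k
  Dwork-defect m k = cong (_- Φ m k) (Λ-CHpX-coeff m k)

  CondII-defect : ∀ m k → P ^ℚ k * Φ (m ℕ.* p) k - Φ m k ≡ expCoeff k * (P ^ℚ k * B k (m ℕ.* p) - B k m)
  CondII-defect m k = trans (cong₂ (λ x y → P ^ℚ k * x - y) (Φ-coeff (m ℕ.* p) k) (Φ-coeff m k))
    (solve 4 (λ a c x y → a :* (c :* x) :- c :* y := c :* (a :* x :- y))
       refl (P ^ℚ k) (expCoeff k) (B k (m ℕ.* p)) (B k m))

proposition7p7 : (p : ℕ) → Prime p → 5 ≤ p →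
    (CondI p ⇔ CondII p) × ((Dwork p → CondI p × CondII p) × (Dwork p ⇔ CondII p))
proposition7p7 p p-prime 5≤p =
  mk⇔ I⇒II II⇒I , (λ dwork → II⇒I (Dwork⇒II dwork) , Dwork⇒II dwork) , mk⇔ Dwork⇒II II⇒Dwork
  where
  I⇒II : CondI p → CondII p
  I⇒II condI m 1≤m k = subst (InPowZp p 4) (sym (CondII-defect p m (toℕ k)))
    (InPowZp-*ˡ p-prime 4 (expCoeff (toℕ k)) _
      (InZp-expCoeff p-prime (ℕₚ.<-trans (Finₚ.toℕ<n k) 5≤p)) (condI m 1≤m k))
  II⇒I : CondII p → CondI p
  II⇒I condII m 1≤m k = InPowZp-cancelˡ p-prime 4 (expCoeff⁻¹ (toℕ k)) (expCoeff (toℕ k)) _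
    (InZp-expCoeff⁻¹ p-prime (toℕ k)) (expCoeff⁻¹*expCoeff (toℕ k))
    (subst (InPowZp p 4) (CondII-defect p m (toℕ k)) (condII m 1≤m k))
  Dwork⇒II : Dwork p → CondII p
  Dwork⇒II dwork m _ k = subst (InPowZp p 4) (Dwork-defect p m (toℕ k)) (dwork m k)
  II⇒Dwork : CondII p → Dwork p
  II⇒Dwork _ zero k = subst (InPowZp p 4)
    (sym (trans (Dwork-defect p 0 (toℕ k)) (x^k*Φ₀-Φ₀≡0 (ℕ→ℚ p) (toℕ k)))) (InPowZp-0 p-prime 4)
  II⇒Dwork condII m@(suc _) k = subst (InPowZp p 4) (sym (Dwork-defect p m (toℕ k))) (condII m (s≤s z≤n) k)
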